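{- Let $G$ be a finite simple graph with $n$ vertices, and let $\kappa_{odd}(G)$ be the number of vertices not contained in any odd cycle of $G$. If $G$ is not bipartite, then \[\mathrm{girth}(G)-1+\kappa_{odd}(G)\leq ir_{odd}(G);\] if $G$ is bipartite, then $ir_{odd}(G)=n$.
   Context: $\mathrm{girth}(G)$ is the length of a shortest cycle. For $S\subseteq V$, $\langle S\rangle$ is the induced subgraph. For $T\subseteq V$ and $x\in V$, say $T$ dominates $x$ if $x\in T$, or $x\notin T$ and there is $w\in T$ such that $x,w$ lie on a common odd cycle of $\langle T\cup\{x\}\rangle$. A set $S$ is odd-cycle irredundant if for every $v\in S$ there exists $u\in (V\setminus S)\cup\{v\}$ such that $S$ dominates $u$ but $S\setminus\{v\}$ does not dominate $u$. $ir_{odd}(G)$ is the minimum size of a maximal odd-cycle irredundant set (one with no odd-cycle irredundant proper superset). -}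

module Defs where

open import Data.Nat using (ℕ; zero; suc; _+_; _*_; _≤_)
open import Data.Fin using (Fin; zero; suc; inject₁; fromℕ)
open import Data.Fin.Subset using (Subset; _∈_; _∉_; _⊂_; _∪_; _-_; ⁅_⁆; ∣_∣)
open import Data.Bool using (Bool)
open import Data.Product using (Σ; ∃; _×_; _,_)
open import Data.Sum using (_⊎_)
open import Relation.Nullary using (¬_)
open import Relation.Binary using (Decidable)
open import Relation.Binary.PropositionalEquality using (_≡_; _≢_)
open import Function.Definitions using (Injective)
open import Function.Bundles using (_⇔_)

record Graph (n : ℕ) : Set₁ where
  field
    Adj    : Fin n → Fin n → Set
    adj?   : Decidable Adj
    sym    : ∀ {u v} → Adj u v → Adj v u
    irrefl : ∀ {u} → ¬ Adj u u
open Graph public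

Odd : ℕ → Set
Odd k = ∃ λ m → k ≡ suc (2 * m)

-- A cycle of G of length (suc m) (≥ 3): distinct vertices c 0, …, c m,
-- consecutive ones adjacent, and c m adjacent to c 0.
record Cycle {n : ℕ} (G : Graph n) : Set where
  field
    m        : ℕ
    long     : 2 ≤ m
    vtx      : Fin (suc m) → Fin n
    distinct : Injective _≡_ _≡_ vtx
    step     : ∀ (i : Fin m) → Adj G (vtx (inject₁ i)) (vtx (suc i))
    close    : Adj G (vtx (fromℕ m)) (vtx zero)
open Cycle public

len : ∀ {n} {G : Graph n} → Cycle G → ℕ
len C = suc (m C)

_OnCycle_ : ∀ {n} {G : Graph n} → Fin n → Cycle G → Set
x OnCycle C = ∃ λ i → vtx C i ≡ x

-- C is a cycle of the induced subgraph ⟨T⟩ (all its vertices lie in T;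
-- induced subgraph keeps exactly the edges of G among T)
CycleIn : ∀ {n} {G : Graph n} → Subset n → Cycle G → Set
CycleIn T C = ∀ i → vtx C i ∈ T

OddCycle : ∀ {n} {G : Graph n} → Cycle G → Set
OddCycle C = Odd (len C)

IsGirth : ∀ {n} → Graph n → ℕ → Set
IsGirth G g = (Σ (Cycle G) λ C → len C ≡ g) × (∀ (C : Cycle G) → g ≤ len C)

Bipartite : ∀ {n} → Graph n → Set
Bipartite {n} G = Σ (Fin n → Bool) λ col → ∀ u v → Adj G u v → col u ≢ col v

OnOddCycle : ∀ {n} → Graph n → Fin n → Set
OnOddCycle G v = Σ (Cycle G) λ C → OddCycle C × v OnCycle C

IsKappaOdd : ∀ {n} → Graph n → ℕ → Set
IsKappaOdd {n} G k =
  Σ (Subset n) λ K → (∀ v → (v ∈ K) ⇔ (¬ OnOddCycle G v)) × ∣ K ∣ ≡ k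

Dominates : ∀ {n} → Graph n → Subset n → Fin n → Set
Dominates {n} G T x =
  x ∈ T ⊎
  (x ∉ T × Σ (Fin n) λ w → w ∈ T ×
     Σ (Cycle G) λ C → OddCycle C × CycleIn (T ∪ ⁅ x ⁆) C × x OnCycle C × w OnCycle C)

OddCycleIrredundant : ∀ {n} → Graph n → Subset n → Set
OddCycleIrredundant {n} G S =
  ∀ v → v ∈ S → Σ (Fin n) λ u → (u ∉ S ⊎ u ≡ v) ×
    Dominates G S u × ¬ Dominates G (S - v) u

MaximalOCI : ∀ {n} → Graph n → Subset n → Set
MaximalOCI {n} G S =
  OddCycleIrredundant G S × (∀ (S′ : Subset n) → S ⊂ S′ → ¬ OddCycleIrredundant G S′)

IsIrOdd : ∀ {n} → Graph n → ℕ → Set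
IsIrOdd {n} G r =
  (Σ (Subset n) λ S → MaximalOCI G S × ∣ S ∣ ≡ r) ×
  (∀ (S : Subset n) → MaximalOCI G S → r ≤ ∣ S ∣)

-- Let K be the vertices on no odd cycle, S a maximal odd-cycle irredundant set and
-- D = S ∖ K. A vertex of K lies on no odd cycle, so adding it to S dominates nothing new
-- besides itself; maximality thus forces K ⊆ S and |S| ≥ |K| + |D|. If |D| + 1 < g, for any
-- x ∉ S every odd cycle that could witness a domination in S ∪ {x} has all its vertices
-- outside K among fewer than g vertices, which the girth forbids; so x could be added,
-- hence S = V and every odd cycle lies in D, again too short. Thus G has no odd cycle and
-- is bipartite; as the bound is decidable, this is needed only in double-negated form,
-- obtained by colouring each vertex by the parity of a walk from its component's root.
-- In a bipartite graph domination is membership, every set is irredundant and V is the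
-- only maximal one.

module Submission where

open import Defs renaming (sym to adj-sym)
open import Data.Bool using (Bool; true; false; not; _xor_)
open import Data.Bool.Properties
  using (not-involutive; not-distribˡ-xor; not-distribʳ-xor; xor-same; xor-identityʳ; ¬-not)
open import Data.Empty using (⊥; ⊥-elim)
open import Data.Fin using (Fin; zero; suc; toℕ; inject₁; fromℕ)
open import Data.Fin.Induction using (<-weakInduction)
open import Data.Fin.Properties
  using (any?; injective⇒≤; suc-injective; toℕ<n; toℕ-inject₁; toℕ-fromℕ; sequence)
  renaming (_≟_ to _≟ᶠ_; <-cmp to <ᶠ-cmp)
open import Data.Fin.Subset
  using (Subset; _∈_; _∉_; _⊆_; _⊂_; _-_; ⊤; _∪_; _∩_; ∁; _─_; ⁅_⁆; ∣_∣; inside; outside)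
open import Data.Fin.Subset.Properties
  using (∣⁅x⁆∣≡1; x∈p∪q⁻; x∈p∪q⁺; x∈⁅x⁆; x∈⁅y⁆⇒x≡y; x∈p∧x≢y⇒x∈p-y; p─q⊆p; p⊆p∪q; _∈?_;
         x∈p∩q⁺; x∉p⇒x∈∁p; p⊆q⇒∣p∣≤∣q∣; x∈p⇒∣p-x∣<∣p∣; ∈⊤; ∣⊤∣≡n)
open import Data.Maybe using (Maybe; just; nothing)
import Data.Maybe as Maybe
open import Data.Nat using (ℕ; zero; suc; _+_; _*_; _∸_; _≤_; _<_; z≤n; s≤s; _≤?_; _<?_)
open import Data.Nat.Induction using (<-rec)
open import Data.Nat.Properties hiding (suc-injective)
import Data.Nat.Properties as ℕ
open import Data.Product using (Σ; ∃; _×_; _,_; proj₁; proj₂; uncurry)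
open import Data.Sum using (_⊎_; inj₁; inj₂; [_,_]′)
import Data.Sum as Sum
open import Data.Vec using ([]; _∷_; here; there)
open import Effect.Monad using (RawMonad)
open import Function using (_∘_)
open import Function.Bundles using (_⇔_; Equivalence)
open import Function.Definitions using (Injective)
open import Relation.Binary.Definitions using (tri<; tri≈; tri>)
open import Relation.Binary.PropositionalEquality
open import Relation.Nullary using (¬_; Dec; yes; no; does)
open import Relation.Nullary.Decidable using (_×-dec_; _⊎-dec_; ¬¬-excluded-middle)
open import Relation.Nullary.Negation using (¬¬-Monad)
import Relation.Unary as U

rank : ∀ {n} (p : Subset n) {x} → x ∈ p → Fin ∣ p ∣
rank (inside ∷ p) here = zero
rank (inside ∷ p) (there x∈p) = suc (rank p x∈p)
rank (outside ∷ p) (there x∈p) = rank p x∈p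

rank-injective : ∀ {n} (p : Subset n) {x y} (x∈p : x ∈ p) (y∈p : y ∈ p) →
                 rank p x∈p ≡ rank p y∈p → x ≡ y
rank-injective (inside ∷ p) here here _ = refl
rank-injective (inside ∷ p) (there x∈p) (there y∈p) e =
  cong suc (rank-injective p x∈p y∈p (suc-injective e))
rank-injective (outside ∷ p) (there x∈p) (there y∈p) e = cong suc (rank-injective p x∈p y∈p e)

injective⇒≤∣p∣ : ∀ {a n} {f : Fin a → Fin n} (p : Subset n) →
                 Injective _≡_ _≡_ f → (∀ i → f i ∈ p) → a ≤ ∣ p ∣
injective⇒≤∣p∣ p f-inj f∈p = injective⇒≤ λ {i} {j} e → f-inj (rank-injective p (f∈p i) (f∈p j) e)

∣p∪q∣≤∣p∣+∣q∣ : ∀ {n} (p q : Subset n) → ∣ p ∪ q ∣ ≤ ∣ p ∣ + ∣ q ∣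
∣p∪q∣≤∣p∣+∣q∣ [] [] = z≤n
∣p∪q∣≤∣p∣+∣q∣ (outside ∷ p) (outside ∷ q) = ∣p∪q∣≤∣p∣+∣q∣ p q
∣p∪q∣≤∣p∣+∣q∣ (outside ∷ p) (inside ∷ q) =
  subst (suc ∣ p ∪ q ∣ ≤_) (sym (+-suc ∣ p ∣ ∣ q ∣)) (s≤s (∣p∪q∣≤∣p∣+∣q∣ p q))
∣p∪q∣≤∣p∣+∣q∣ (inside ∷ p) (outside ∷ q) = s≤s (∣p∪q∣≤∣p∣+∣q∣ p q)
∣p∪q∣≤∣p∣+∣q∣ (inside ∷ p) (inside ∷ q) =
  s≤s (≤-trans (∣p∪q∣≤∣p∣+∣q∣ p q) (+-monoʳ-≤ ∣ p ∣ (n≤1+n ∣ q ∣)))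

∣p∪⁅x⁆∣≤1+∣p∣ : ∀ {n} (p : Subset n) x → ∣ p ∪ ⁅ x ⁆ ∣ ≤ suc ∣ p ∣
∣p∪⁅x⁆∣≤1+∣p∣ p x = subst (∣ p ∪ ⁅ x ⁆ ∣ ≤_) (trans (cong (∣ p ∣ +_) (∣⁅x⁆∣≡1 x)) (+-comm ∣ p ∣ 1))
                         (∣p∪q∣≤∣p∣+∣q∣ p ⁅ x ⁆)

∣p∣≡∣p∩q∣+∣p∩∁q∣ : ∀ {n} (p q : Subset n) → ∣ p ∣ ≡ ∣ p ∩ q ∣ + ∣ p ∩ ∁ q ∣
∣p∣≡∣p∩q∣+∣p∩∁q∣ [] [] = refl
∣p∣≡∣p∩q∣+∣p∩∁q∣ (outside ∷ p) (_ ∷ q) = ∣p∣≡∣p∩q∣+∣p∩∁q∣ p q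
∣p∣≡∣p∩q∣+∣p∩∁q∣ (inside ∷ p) (inside ∷ q) = cong suc (∣p∣≡∣p∩q∣+∣p∩∁q∣ p q)
∣p∣≡∣p∩q∣+∣p∩∁q∣ (inside ∷ p) (outside ∷ q) =
  trans (cong suc (∣p∣≡∣p∩q∣+∣p∩∁q∣ p q)) (sym (+-suc ∣ p ∩ q ∣ ∣ p ∩ ∁ q ∣))

x∈p─q⇒x∉q : ∀ {n} (p q : Subset n) {x} → x ∈ p ─ q → x ∉ q
x∈p─q⇒x∉q (inside ∷ p) (outside ∷ q) here ()
x∈p─q⇒x∉q (_ ∷ p) (_ ∷ q) (there x∈p─q) (there x∈q) = x∈p─q⇒x∉q p q x∈p─q x∈q

oddᵇ : ℕ → Bool
oddᵇ zero = false
oddᵇ (suc n) = not (oddᵇ n)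

oddᵇ-+ : ∀ a b → oddᵇ (a + b) ≡ oddᵇ a xor oddᵇ b
oddᵇ-+ zero b = refl
oddᵇ-+ (suc a) b = trans (cong not (oddᵇ-+ a b)) (not-distribˡ-xor (oddᵇ a) (oddᵇ b))

oddᵇ-2* : ∀ m → oddᵇ (2 * m) ≡ false
oddᵇ-2* m = trans (oddᵇ-+ m (m + 0))
  (trans (cong (λ k → oddᵇ m xor oddᵇ k) (+-identityʳ m)) (xor-same (oddᵇ m)))

Odd⇒oddᵇ : ∀ {L} → Odd L → oddᵇ L ≡ true
Odd⇒oddᵇ (m , refl) = cong not (oddᵇ-2* m)

oddᵇ⇒Odd : ∀ L → oddᵇ L ≡ true → Odd L
oddᵇ⇒Odd zero ()
oddᵇ⇒Odd (suc zero) _ = 0 , refl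
oddᵇ⇒Odd (suc (suc L)) odd with oddᵇ⇒Odd L (trans (sym (not-involutive (oddᵇ L))) odd)
... | m , refl = suc m , cong (λ k → suc (suc k)) (sym (+-suc m (m + 0)))

p⊆q⇒p∪r⊆q∪r : ∀ {n} {p q : Subset n} (r : Subset n) → p ⊆ q → p ∪ r ⊆ q ∪ r
p⊆q⇒p∪r⊆q∪r {p = p} r p⊆q x∈p∪r with x∈p∪q⁻ p r x∈p∪r
... | inj₁ x∈p = x∈p∪q⁺ (inj₁ (p⊆q x∈p))
... | inj₂ x∈r = x∈p∪q⁺ (inj₂ x∈r)

x∈p∪⁅y⁆∧x≢y⇒x∈p : ∀ {n} {p : Subset n} {x y} → x ∈ p ∪ ⁅ y ⁆ → x ≢ y → x ∈ p
x∈p∪⁅y⁆∧x≢y⇒x∈p {p = p} {x} {y} x∈ x≢y with x∈p∪q⁻ p ⁅ y ⁆ x∈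
... | inj₁ x∈p = x∈p
... | inj₂ x∈⁅y⁆ = ⊥-elim (x≢y (x∈⁅y⁆⇒x≡y y x∈⁅y⁆))

x∈p-y⇒x≢y : ∀ {n} {p : Subset n} {x y} → x ∈ p - y → x ≢ y
x∈p-y⇒x≢y {p = p} {y = y} x∈p-y refl = x∈p─q⇒x∉q p ⁅ y ⁆ x∈p-y (x∈⁅x⁆ y)

first : ∀ {m} {P : Fin m → Set} → U.Decidable P → Maybe (Fin m)
first {zero} P? = nothing
first {suc m} P? with P? zero
... | yes _ = just zero
... | no _ = Maybe.map suc (first (P? ∘ suc))

first-just : ∀ {m} {P : Fin m → Set} (P? : U.Decidable P) {i} → P i →
             ∃ λ r → first P? ≡ just r × P r
first-just {suc m} P? {i} Pi with P? zero
... | yes P0 = zero , refl , P0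
first-just {suc m} P? {zero} P0 | no ¬P0 = ⊥-elim (¬P0 P0)
first-just {suc m} P? {suc i} Pi | no _ with first-just (P? ∘ suc) Pi
... | r , first≡r , Pr = suc r , cong (Maybe.map suc) first≡r , Pr

first-cong : ∀ {m} {P Q : Fin m → Set} (P? : U.Decidable P) (Q? : U.Decidable Q) →
             (∀ i → P i → Q i) → (∀ i → Q i → P i) → first P? ≡ first Q?
first-cong {zero} P? Q? P⇒Q Q⇒P = refl
first-cong {suc m} P? Q? P⇒Q Q⇒P with P? zero | Q? zero
... | yes _ | yes _ = refl
... | yes P0 | no ¬Q0 = ⊥-elim (¬Q0 (P⇒Q zero P0))
... | no ¬P0 | yes Q0 = ⊥-elim (¬P0 (Q⇒P zero Q0))
... | no _ | no _ = cong (Maybe.map suc) (first-cong (P? ∘ suc) (Q? ∘ suc) (P⇒Q ∘ suc) (Q⇒P ∘ suc))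

module _ {n : ℕ} (G : Graph n) where

  record ClosedWalk (L : ℕ) : Set where
    field
      vertex  : ℕ → Fin n
      edge    : ∀ i → i < L → Adj G (vertex i) (vertex (suc i))
      returns : vertex L ≡ vertex 0
  open ClosedWalk

  RepeatsVertex : ∀ {L} → ClosedWalk L → Set
  RepeatsVertex {L} w = ∃ λ (i : Fin L) → ∃ λ (j : Fin L) →
    toℕ i < toℕ j × vertex w (toℕ i) ≡ vertex w (toℕ j)

  repeatsVertex? : ∀ {L} (w : ClosedWalk L) → Dec (RepeatsVertex w)
  repeatsVertex? w = any? λ i → any? λ j →
    (toℕ i <? toℕ j) ×-dec (vertex w (toℕ i) ≟ᶠ vertex w (toℕ j))

  ¬repeats⇒injective : ∀ {L} (w : ClosedWalk L) → ¬ RepeatsVertex w →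
                       Injective _≡_ _≡_ (vertex w ∘ toℕ {L})
  ¬repeats⇒injective w ¬rep {i} {j} e with <ᶠ-cmp i j
  ... | tri< i<j _ _ = ⊥-elim (¬rep (i , j , i<j , e))
  ... | tri≈ _ i≡j _ = i≡j
  ... | tri> _ _ j<i = ⊥-elim (¬rep (j , i , j<i , sym e))

  -- The only odd length below 3 is 1, a loop, which irreflexivity excludes.
  simpleOddClosedWalk⇒oddCycle : ∀ L → oddᵇ L ≡ true → (w : ClosedWalk L) → ¬ RepeatsVertex w →
                                  Σ (Cycle G) OddCycle
  simpleOddClosedWalk⇒oddCycle (suc zero) _ w _ =
    ⊥-elim (irrefl G (subst (Adj G (vertex w 0)) (returns w) (edge w 0 (s≤s z≤n))))
  simpleOddClosedWalk⇒oddCycle (suc (suc (suc k))) odd w ¬rep = C , oddᵇ⇒Odd _ odd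
    where
    M : ℕ
    M = suc (suc k)
    C : Cycle G
    C = record
      { m        = M
      ; long     = s≤s (s≤s z≤n)
      ; vtx      = vertex w ∘ toℕ
      ; distinct = ¬repeats⇒injective w ¬rep
      ; step     = λ i → subst (λ a → Adj G (vertex w a) (vertex w (suc (toℕ i))))
                             (sym (toℕ-inject₁ i)) (edge w (toℕ i) (m<n⇒m<1+n (toℕ<n i)))
      ; close    = subst (λ a → Adj G (vertex w a) (vertex w 0)) (sym (toℕ-fromℕ M))
                     (subst (Adj G (vertex w M)) (returns w) (edge w M (n<1+n M)))
      }

  -- A repeated vertex vertex i = vertex j cuts the closed walk into the loop between
  -- positions i and j and the shortcut that skips it; their lengths add up to L.
  module Split {L} (w : ClosedWalk L) {i j} (i<j : i < j) (j<L : j < L)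
               (repeat : vertex w i ≡ vertex w j) where

    d : ℕ
    d = j ∸ i

    i+d≡j : i + d ≡ j
    i+d≡j = m+[n∸m]≡n (<⇒≤ i<j)

    d≤L : d ≤ L
    d≤L = ≤-trans (m∸n≤m j i) (<⇒≤ j<L)

    loop : ClosedWalk d
    loop = record { vertex = λ k → vertex w (i + k) ; edge = loop-edge ; returns = loop-returns }
      where
      loop-edge : ∀ k → k < d → Adj G (vertex w (i + k)) (vertex w (i + suc k))
      loop-edge k k<d = subst (λ a → Adj G (vertex w (i + k)) (vertex w a)) (sym (+-suc i k))
        (edge w (i + k) (<-≤-trans (subst (i + k <_) i+d≡j (+-monoʳ-< i k<d)) (<⇒≤ j<L)))
      loop-returns : vertex w (i + d) ≡ vertex w (i + 0)
      loop-returns = trans (cong (vertex w) i+d≡j) (trans (sym repeat) (cong (vertex w) (sym (+-identityʳ i))))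

    skip : (k : ℕ) → Dec (k ≤ i) → Fin n
    skip k (yes _) = vertex w k
    skip k (no _) = vertex w (k + d)

    i<L∸d : i < L ∸ d
    i<L∸d = m+n≤o⇒m≤o∸n (suc i) (subst (_≤ L) (cong suc (sym i+d≡j)) j<L)

    shortcut : ClosedWalk (L ∸ d)
    shortcut = record
      { vertex  = λ k → skip k (k ≤? i)
      ; edge    = λ k k< → skip-edge k k< (k ≤? i) (suc k ≤? i)
      ; returns = skip-returns (L ∸ d ≤? i) (0 ≤? i) }
      where
      skip-edge : ∀ k → k < L ∸ d → (a : Dec (k ≤ i)) (b : Dec (suc k ≤ i)) →
                  Adj G (skip k a) (skip (suc k) b)
      skip-edge k _ (yes k≤i) (yes _) = edge w k (<-≤-trans (s≤s k≤i) (≤-trans i<j (<⇒≤ j<L)))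
      skip-edge k _ (yes k≤i) (no k≮i) with ≤-antisym k≤i (≮⇒≥ k≮i)
      ... | refl = subst (λ a → Adj G a (vertex w (suc (k + d)))) (sym repeat)
                     (subst (λ a → Adj G (vertex w j) (vertex w (suc a))) (sym i+d≡j) (edge w j j<L))
      skip-edge k _ (no k≰i) (yes k<i) = ⊥-elim (k≰i (≤-trans (n≤1+n k) k<i))
      skip-edge k k< (no _) (no _) = edge w (k + d) (subst (k + d <_) (m∸n+n≡m d≤L) (+-monoˡ-< d k<))
      skip-returns : (a : Dec (L ∸ d ≤ i)) (b : Dec (0 ≤ i)) → skip (L ∸ d) a ≡ skip 0 b
      skip-returns (yes L∸d≤i) _ = ⊥-elim (<⇒≱ i<L∸d L∸d≤i)
      skip-returns (no _) (no 0≰i) = ⊥-elim (0≰i z≤n)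
      skip-returns (no _) (yes _) = trans (cong (vertex w) (m∸n+n≡m d≤L)) (returns w)

    loop-shorter : d < L
    loop-shorter = ≤-<-trans (m∸n≤m j i) j<L

    shortcut-shorter : L ∸ d < L
    shortcut-shorter = ∸-monoʳ-< (m<n⇒0<n∸m i<j) d≤L

    loop-or-shortcut-odd : oddᵇ L ≡ true → oddᵇ d ≡ true ⊎ oddᵇ (L ∸ d) ≡ true
    loop-or-shortcut-odd odd =
      xor≡true (trans (sym (oddᵇ-+ d (L ∸ d))) (trans (cong oddᵇ (m+[n∸m]≡n d≤L)) odd))
      where
      xor≡true : ∀ {x y} → x xor y ≡ true → x ≡ true ⊎ y ≡ true
      xor≡true {true} _ = inj₁ refl
      xor≡true {false} y≡true = inj₂ y≡true

  oddClosedWalk⇒oddCycle : ∀ L → oddᵇ L ≡ true → ClosedWalk L → Σ (Cycle G) OddCycle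
  oddClosedWalk⇒oddCycle = <-rec _ extract
    where
    extract : ∀ L → (∀ {L′} → L′ < L → oddᵇ L′ ≡ true → ClosedWalk L′ → Σ (Cycle G) OddCycle) →
              oddᵇ L ≡ true → ClosedWalk L → Σ (Cycle G) OddCycle
    extract L shorter odd w with repeatsVertex? w
    ... | no ¬rep = simpleOddClosedWalk⇒oddCycle L odd w ¬rep
    ... | yes (i , j , i<j , repeat) =
      let open Split w i<j (toℕ<n j) repeat in
      [ (λ odd-loop → shorter loop-shorter odd-loop loop)
      , (λ odd-shortcut → shorter shortcut-shorter odd-shortcut shortcut) ]′ (loop-or-shortcut-odd odd)

  data Walk : Fin n → Fin n → ℕ → Set where
    []  : ∀ {u} → Walk u u 0
    _∷_ : ∀ {u v w l} → Adj G u v → Walk v w l → Walk u w (suc l)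

  _∷ʳ_ : ∀ {u v w l} → Walk u v l → Adj G v w → Walk u w (suc l)
  [] ∷ʳ e = e ∷ []
  (e′ ∷ p) ∷ʳ e = e′ ∷ (p ∷ʳ e)

  _++_ : ∀ {u v w l₁ l₂} → Walk u v l₁ → Walk v w l₂ → Walk u w (l₁ + l₂)
  [] ++ q = q
  (e ∷ p) ++ q = e ∷ (p ++ q)

  reverse : ∀ {u v l} → Walk u v l → Walk v u l
  reverse [] = []
  reverse (e ∷ p) = reverse p ∷ʳ adj-sym G e

  vertexAt : ∀ {u v l} → Walk u v l → ℕ → Fin n
  vertexAt {u} [] _ = u
  vertexAt {u} (_ ∷ _) zero = u
  vertexAt (_ ∷ p) (suc k) = vertexAt p k

  vertexAt-start : ∀ {u v l} (p : Walk u v l) → vertexAt p 0 ≡ u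
  vertexAt-start [] = refl
  vertexAt-start (_ ∷ _) = refl

  vertexAt-end : ∀ {u v l} (p : Walk u v l) → vertexAt p l ≡ v
  vertexAt-end [] = refl
  vertexAt-end (_ ∷ p) = vertexAt-end p

  vertexAt-edge : ∀ {u v l} (p : Walk u v l) i → i < l → Adj G (vertexAt p i) (vertexAt p (suc i))
  vertexAt-edge (e ∷ p) zero _ = subst (Adj G _) (sym (vertexAt-start p)) e
  vertexAt-edge (_ ∷ p) (suc i) (s≤s i<l) = vertexAt-edge p i i<l

  toClosedWalk : ∀ {u l} → Walk u u l → ClosedWalk l
  toClosedWalk p = record
    { vertex = vertexAt p ; edge = vertexAt-edge p
    ; returns = trans (vertexAt-end p) (sym (vertexAt-start p)) }

  ParityWalk : Bool → Fin n → Fin n → Set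
  ParityWalk b u v = ∃ λ l → oddᵇ l ≡ b × Walk u v l

  _∷ʳᵖ_ : ∀ {b u v w} → ParityWalk b u v → Adj G v w → ParityWalk (not b) u w
  (l , refl , p) ∷ʳᵖ e = suc l , refl , p ∷ʳ e

  oppositeParityWalks⇒oddCycle : ∀ {b u v} → ParityWalk b u v → ParityWalk (not b) u v →
                                 Σ (Cycle G) OddCycle
  oppositeParityWalks⇒oddCycle {b} (l₁ , refl , p₁) (l₂ , l₂-parity , p₂) =
    oddClosedWalk⇒oddCycle (l₁ + l₂) odd (toClosedWalk (reverse p₁ ++ p₂))
    where
    odd : oddᵇ (l₁ + l₂) ≡ true
    odd = begin
      oddᵇ (l₁ + l₂)              ≡⟨ oddᵇ-+ l₁ l₂ ⟩
      oddᵇ l₁ xor oddᵇ l₂         ≡⟨ cong (oddᵇ l₁ xor_) l₂-parity ⟩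
      oddᵇ l₁ xor not (oddᵇ l₁)   ≡⟨ sym (not-distribʳ-xor (oddᵇ l₁) (oddᵇ l₁)) ⟩
      not (oddᵇ l₁ xor oddᵇ l₁)   ≡⟨ cong not (xor-same (oddᵇ l₁)) ⟩
      true                        ∎
      where open ≡-Reasoning

  -- Colour v by the parity of a walk from the first vertex of its component;
  -- absence of odd cycles makes this parity independent of the walk.
  module Colouring (noOddCycle : ∀ (C : Cycle G) → ¬ OddCycle C)
                   (walk? : ∀ r v → Dec (ParityWalk false r v) × Dec (ParityWalk true r v)) where

    Connected : Fin n → Fin n → Set
    Connected r v = ParityWalk false r v ⊎ ParityWalk true r v

    connected-step : ∀ {r u v} → Adj G u v → Connected r u → Connected r v
    connected-step e (inj₁ p) = inj₂ (p ∷ʳᵖ e)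
    connected-step e (inj₂ p) = inj₁ (p ∷ʳᵖ e)

    connected? : ∀ r v → Dec (Connected r v)
    connected? r v = proj₁ (walk? r v) ⊎-dec proj₂ (walk? r v)

    root : Fin n → Maybe (Fin n)
    root v = first λ r → connected? r v

    colourFrom : Maybe (Fin n) → Fin n → Bool
    colourFrom nothing _ = false  -- unreachable: every vertex is connected to itself
    colourFrom (just r) v = does (proj₁ (walk? r v))

    colour : Fin n → Bool
    colour v = colourFrom (root v) v

    parity-flips : ∀ {r u v} → Adj G u v → Connected r u →
                   does (proj₁ (walk? r u)) ≢ does (proj₁ (walk? r v))
    parity-flips {r} {u} {v} e c with proj₁ (walk? r u) | proj₁ (walk? r v)
    ... | yes even-u | yes even-v =
      λ _ → uncurry noOddCycle (oppositeParityWalks⇒oddCycle even-v (even-u ∷ʳᵖ e))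
    ... | yes _ | no _ = λ ()
    ... | no _ | yes _ = λ ()
    ... | no ¬even-u | no ¬even-v with c
    ...   | inj₁ even-u = ⊥-elim (¬even-u even-u)
    ...   | inj₂ odd-u = ⊥-elim (¬even-v (odd-u ∷ʳᵖ e))

    colour-proper : ∀ u v → Adj G u v → colour u ≢ colour v
    colour-proper u v e colours≡ with first-just (λ r → connected? r v) (inj₁ (0 , refl , []))
    ... | r , root-v , r~v = parity-flips e r~u (begin
      does (proj₁ (walk? r u)) ≡⟨ cong (λ ρ → colourFrom ρ u) (sym root-u) ⟩
      colour u                 ≡⟨ colours≡ ⟩
      colour v                 ≡⟨ cong (λ ρ → colourFrom ρ v) root-v ⟩
      does (proj₁ (walk? r v)) ∎)
      where
      open ≡-Reasoning
      root-u : root u ≡ just r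
      root-u = trans (first-cong _ _ (λ _ → connected-step e) (λ _ → connected-step (adj-sym G e))) root-v
      r~u : Connected r u
      r~u = connected-step (adj-sym G e) r~v

  noOddCycle⇒¬¬bipartite : (∀ (C : Cycle G) → ¬ OddCycle C) → ¬ ¬ Bipartite G
  noOddCycle⇒¬¬bipartite noOddCycle ¬bipartite = ¬¬-walk? λ walk? →
    let open Colouring noOddCycle walk? in ¬bipartite (colour , colour-proper)
    where
    open RawMonad ¬¬-Monad
    ¬¬-walk? : ¬ ¬ (∀ r v → Dec (ParityWalk false r v) × Dec (ParityWalk true r v))
    ¬¬-walk? = sequence rawApplicative λ r → sequence rawApplicative λ v →
      _,_ <$> ¬¬-excluded-middle <*> ¬¬-excluded-middle

  bipartite⇒noOddCycle : Bipartite G → (C : Cycle G) → ¬ OddCycle C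
  bipartite⇒noOddCycle (colour , proper) C (k , len≡) = proper _ _ (close C) last≡first
    where
    c₀ : Bool
    c₀ = colour (vtx C zero)
    alternates : ∀ i → colour (vtx C i) ≡ c₀ xor oddᵇ (toℕ i)
    alternates = <-weakInduction (λ i → colour (vtx C i) ≡ c₀ xor oddᵇ (toℕ i))
      (sym (xor-identityʳ c₀)) λ i ih → begin
        colour (vtx C (suc i))                    ≡⟨ ¬-not (≢-sym (proper _ _ (step C i))) ⟩
        not (colour (vtx C (inject₁ i)))          ≡⟨ cong not ih ⟩
        not (c₀ xor oddᵇ (toℕ (inject₁ i)))       ≡⟨ cong (λ a → not (c₀ xor oddᵇ a)) (toℕ-inject₁ i) ⟩
        not (c₀ xor oddᵇ (toℕ i))                 ≡⟨ not-distribʳ-xor c₀ (oddᵇ (toℕ i)) ⟩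
        c₀ xor oddᵇ (suc (toℕ i))                 ∎
      where open ≡-Reasoning
    last≡first : colour (vtx C (fromℕ (m C))) ≡ c₀
    last≡first = begin
      colour (vtx C (fromℕ (m C)))     ≡⟨ alternates (fromℕ (m C)) ⟩
      c₀ xor oddᵇ (toℕ (fromℕ (m C)))  ≡⟨ cong (λ a → c₀ xor oddᵇ a) m≡2k ⟩
      c₀ xor oddᵇ (2 * k)              ≡⟨ cong (c₀ xor_) (oddᵇ-2* k) ⟩
      c₀ xor false                     ≡⟨ xor-identityʳ c₀ ⟩
      c₀                               ∎
      where
      open ≡-Reasoning
      m≡2k : toℕ (fromℕ (m C)) ≡ 2 * k
      m≡2k = trans (toℕ-fromℕ (m C)) (ℕ.suc-injective len≡)

  dominates-mono : ∀ {T T′ x} → T ⊆ T′ → Dominates G T x → Dominates G T′ x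
  dominates-mono T⊆T′ (inj₁ x∈T) = inj₁ (T⊆T′ x∈T)
  dominates-mono {T′ = T′} {x} T⊆T′ (inj₂ (_ , w , w∈T , C , odd , C⊆ , x∈C , w∈C)) with x ∈? T′
  ... | yes x∈T′ = inj₁ x∈T′
  ... | no x∉T′ = inj₂ (x∉T′ , w , T⊆T′ w∈T , C , odd , p⊆q⇒p∪r⊆q∪r ⁅ x ⁆ T⊆T′ ∘ C⊆ , x∈C , w∈C)

  dominated-outside⇒onOddCycle : ∀ {T x} → x ∉ T → Dominates G T x → OnOddCycle G x
  dominated-outside⇒onOddCycle x∉T (inj₁ x∈T) = ⊥-elim (x∉T x∈T)
  dominated-outside⇒onOddCycle _ (inj₂ (_ , _ , _ , C , odd , _ , x∈C , _)) = C , odd , x∈C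

  dominates-remove : ∀ {T u y} → ¬ OnOddCycle G y → u ≢ y → Dominates G T u → Dominates G (T - y) u
  dominates-remove _ u≢y (inj₁ u∈T) = inj₁ (x∈p∧x≢y⇒x∈p-y u∈T u≢y)
  dominates-remove {T} {u} {y} ¬onOdd _ (inj₂ (u∉T , w , w∈T , C , odd , C⊆ , u∈C , i , refl)) =
    inj₂ (u∉T ∘ p─q⊆p T ⁅ y ⁆ , w , x∈p∧x≢y⇒x∈p-y w∈T (avoids i) , C , odd , C⊆′ , u∈C , i , refl)
    where
    avoids : ∀ j → vtx C j ≢ y
    avoids j refl = ¬onOdd (C , odd , j , refl)
    C⊆′ : CycleIn ((T - y) ∪ ⁅ u ⁆) C
    C⊆′ j with x∈p∪q⁻ T ⁅ u ⁆ (C⊆ j)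
    ... | inj₁ ∈T = x∈p∪q⁺ (inj₁ (x∈p∧x≢y⇒x∈p-y ∈T (avoids j)))
    ... | inj₂ ∈⁅u⁆ = x∈p∪q⁺ (inj₂ ∈⁅u⁆)

  -- OddCycleIrredundant G S unfolds to ∀ v → v ∈ S → ∃ (Private S v).
  Private : Subset n → Fin n → Fin n → Set
  Private S v u = (u ∉ S ⊎ u ≡ v) × Dominates G S u × ¬ Dominates G (S - v) u

  private-offOddCycle : ∀ {S v u} → v ∈ S → ¬ OnOddCycle G v → Private S v u → u ≡ v
  private-offOddCycle _ _ (inj₂ u≡v , _) = u≡v
  private-offOddCycle v∈S ¬onOdd (inj₁ u∉S , dom , ¬dom-v) =
    ⊥-elim (¬dom-v (dominates-remove ¬onOdd (λ { refl → u∉S v∈S }) dom))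

  PreservesPrivates : Subset n → Fin n → Set
  PreservesPrivates S x = ∀ {v u} → v ∈ S → Private S v u → ¬ Dominates G ((S ∪ ⁅ x ⁆) - v) u

  irredundant-∪⁅⁆ : ∀ {S x} → OddCycleIrredundant G S → ¬ Dominates G S x → PreservesPrivates S x →
                    OddCycleIrredundant G (S ∪ ⁅ x ⁆)
  irredundant-∪⁅⁆ {S} {x} irr ¬dom preserves v v∈S∪x with x∈p∪q⁻ S ⁅ x ⁆ v∈S∪x
  ... | inj₂ v∈⁅x⁆ with x∈⁅y⁆⇒x≡y x v∈⁅x⁆
  ...   | refl = x , inj₂ refl , inj₁ (x∈p∪q⁺ (inj₂ (x∈⁅x⁆ x))) , ¬dom ∘ dominates-mono S∪x-x⊆S
    where
    S∪x-x⊆S : (S ∪ ⁅ x ⁆) - x ⊆ S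
    S∪x-x⊆S y∈ = x∈p∪⁅y⁆∧x≢y⇒x∈p (p─q⊆p (S ∪ ⁅ x ⁆) ⁅ x ⁆ y∈) (x∈p-y⇒x≢y y∈)
  irredundant-∪⁅⁆ {S} {x} irr ¬dom preserves v v∈S∪x | inj₁ v∈S with irr v v∈S
  ... | u , u∉S⊎u≡v , dom , ¬dom-v =
    u , Sum.map₁ (λ u∉S u∈ → u∉S (x∈p∪⁅y⁆∧x≢y⇒x∈p u∈ u≢x)) u∉S⊎u≡v , dominates-mono (p⊆p∪q ⁅ x ⁆) dom ,
    preserves v∈S (u∉S⊎u≡v , dom , ¬dom-v)
    where
    u≢x : u ≢ x
    u≢x refl = ¬dom dom

  maximal⇒¬PreservesPrivates : ∀ {S x} → MaximalOCI G S → ¬ Dominates G S x → ¬ PreservesPrivates S x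
  maximal⇒¬PreservesPrivates {S} {x} (irr , maximal) ¬dom preserves =
    maximal (S ∪ ⁅ x ⁆) (p⊆p∪q ⁅ x ⁆ , x , x∈p∪q⁺ (inj₂ (x∈⁅x⁆ x)) , ¬dom ∘ inj₁)
      (irredundant-∪⁅⁆ irr ¬dom preserves)

  offOddCycle⇒∈maximal : ∀ {S y} → MaximalOCI G S → ¬ OnOddCycle G y → y ∈ S
  offOddCycle⇒∈maximal {S} {y} max ¬onOdd with y ∈? S
  ... | yes y∈S = y∈S
  ... | no y∉S = ⊥-elim (maximal⇒¬PreservesPrivates max ¬dom preserves)
    where
    ¬dom : ¬ Dominates G S y
    ¬dom = ¬onOdd ∘ dominated-outside⇒onOddCycle y∉S
    preserves : PreservesPrivates S y
    preserves {v} {u} v∈S (_ , dom , ¬dom-v) dom′ =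
      ¬dom-v (dominates-mono shrink (dominates-remove ¬onOdd (λ { refl → ¬dom dom }) dom′))
      where
      shrink : ((S ∪ ⁅ y ⁆) - v) - y ⊆ S - v
      shrink {z} z∈ = x∈p∧x≢y⇒x∈p-y (x∈p∪⁅y⁆∧x≢y⇒x∈p (p─q⊆p _ ⁅ v ⁆ z∈′) (x∈p-y⇒x≢y z∈)) (x∈p-y⇒x≢y z∈′)
        where
        z∈′ : z ∈ (S ∪ ⁅ y ⁆) - v
        z∈′ = p─q⊆p _ ⁅ y ⁆ z∈

girth≤∣p∣ : ∀ {n} {G : Graph n} {g} {p : Subset n} → IsGirth G g → (C : Cycle G) → CycleIn p C → g ≤ ∣ p ∣
girth≤∣p∣ {p = p} (_ , girth≤) C C⊆p = ≤-trans (girth≤ C) (injective⇒≤∣p∣ p (distinct C) C⊆p)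

module _ {n} {G : Graph n} {g} {K S : Subset n} (girth : IsGirth G g)
         (K-spec : ∀ v → (v ∈ K) ⇔ (¬ OnOddCycle G v)) (max : MaximalOCI G S) where

  private
    D : Subset n
    D = S ∩ ∁ K

    offOddCycle : ∀ {v} → v ∈ K → ¬ OnOddCycle G v
    offOddCycle {v} = Equivalence.to (K-spec v)

    ∈D : ∀ {z} → z ∈ S → z ∉ K → z ∈ D
    ∈D z∈S z∉K = x∈p∩q⁺ (z∈S , x∉p⇒x∈∁p z∉K)

    ∈D∪ : ∀ {A z} → z ∉ K → z ∈ S ∪ A → z ∈ D ∪ A
    ∈D∪ {A} z∉K z∈ = [ x∈p∪q⁺ ∘ inj₁ ∘ (λ z∈S → ∈D z∈S z∉K) , x∈p∪q⁺ ∘ inj₂ ]′ (x∈p∪q⁻ S A z∈)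

  ∣K∣+∣S∩∁K∣≤∣S∣ : ∣ K ∣ + ∣ S ∩ ∁ K ∣ ≤ ∣ S ∣
  ∣K∣+∣S∩∁K∣≤∣S∣ = subst (∣ K ∣ + ∣ D ∣ ≤_) (sym (∣p∣≡∣p∩q∣+∣p∩∁q∣ S K))
    (+-monoˡ-≤ ∣ D ∣ (p⊆q⇒∣p∣≤∣q∣ λ y∈K → x∈p∩q⁺ (offOddCycle⇒∈maximal G max (offOddCycle y∈K) , y∈K)))

  module _ (short : suc ∣ S ∩ ∁ K ∣ < g) where

    private
      noShortOddCycle : ∀ {T} → ∣ T ∣ ≤ suc ∣ D ∣ → (C : Cycle G) → OddCycle C →
                        ¬ (∀ i → vtx C i ∉ K → vtx C i ∈ T)
      noShortOddCycle ∣T∣≤ C odd C⊆ = <⇒≱ (≤-<-trans ∣T∣≤ short)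
        (girth≤∣p∣ girth C λ i → C⊆ i λ ∈K → offOddCycle ∈K (C , odd , i , refl))

      -- A vertex outside S could be added without losing irredundance, contradicting maximality.
      ∈S : ∀ x → x ∈ S
      ∈S x with x ∈? S
      ... | yes x∈S = x∈S
      ... | no x∉S = ⊥-elim (maximal⇒¬PreservesPrivates G max ¬dom preserves)
        where
        ¬dom : ¬ Dominates G S x
        ¬dom (inj₁ x∈S) = x∉S x∈S
        ¬dom (inj₂ (_ , _ , _ , C , odd , C⊆ , _)) =
          noShortOddCycle (∣p∪⁅x⁆∣≤1+∣p∣ D x) C odd λ i z∉K → ∈D∪ z∉K (C⊆ i)

        preserves : PreservesPrivates G S x
        preserves {v} {u} v∈S priv@(_ , dom , ¬dom-v) dom′ with v ∈? K
        ... | yes v∈K = offOddCycle v∈K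
              (dominated-outside⇒onOddCycle G (λ v∈ → x∈p-y⇒x≢y v∈ refl)
                 (subst (Dominates G _) (private-offOddCycle G v∈S (offOddCycle v∈K) priv) dom′))
        ... | no v∉K with dom′
        ...   | inj₁ u∈ = ¬dom-v (inj₁ (x∈p∧x≢y⇒x∈p-y
                  (x∈p∪⁅y⁆∧x≢y⇒x∈p (p─q⊆p _ ⁅ v ⁆ u∈) λ { refl → ¬dom dom }) (x∈p-y⇒x≢y u∈)))
        ...   | inj₂ (_ , _ , _ , C , odd , C⊆ , _) = noShortOddCycle ∣T∣≤ C odd T⊇
          where
          T : Subset n
          T = ((D ∪ ⁅ x ⁆) - v) ∪ ⁅ u ⁆
          ∣T∣≤ : ∣ T ∣ ≤ suc ∣ D ∣
          ∣T∣≤ = ≤-trans (∣p∪⁅x⁆∣≤1+∣p∣ ((D ∪ ⁅ x ⁆) - v) u)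
                   (≤-trans (x∈p⇒∣p-x∣<∣p∣ (x∈p∪q⁺ (inj₁ (∈D v∈S v∉K)))) (∣p∪⁅x⁆∣≤1+∣p∣ D x))
          T⊇ : ∀ i → vtx C i ∉ K → vtx C i ∈ T
          T⊇ i z∉K with x∈p∪q⁻ _ ⁅ u ⁆ (C⊆ i)
          ... | inj₁ z∈ = x∈p∪q⁺ (inj₁ (x∈p∧x≢y⇒x∈p-y (∈D∪ z∉K (p─q⊆p _ ⁅ v ⁆ z∈)) (x∈p-y⇒x≢y z∈)))
          ... | inj₂ z∈⁅u⁆ = x∈p∪q⁺ (inj₂ z∈⁅u⁆)

    shortCore⇒noOddCycle : (C : Cycle G) → ¬ OddCycle C
    shortCore⇒noOddCycle C odd = noShortOddCycle (n≤1+n ∣ D ∣) C odd λ i z∉K → ∈D (∈S (vtx C i)) z∉K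

  girth∸1+∣K∣≤∣S∣ : ¬ Bipartite G → g ∸ 1 + ∣ K ∣ ≤ ∣ S ∣
  girth∸1+∣K∣≤∣S∣ ¬bipartite = begin
    g ∸ 1 + ∣ K ∣   ≤⟨ +-monoˡ-≤ ∣ K ∣ (∸-monoˡ-≤ 1 girth≤1+∣D∣) ⟩
    ∣ D ∣ + ∣ K ∣   ≡⟨ +-comm ∣ D ∣ ∣ K ∣ ⟩
    ∣ K ∣ + ∣ D ∣   ≤⟨ ∣K∣+∣S∩∁K∣≤∣S∣ ⟩
    ∣ S ∣           ∎
    where
    open ≤-Reasoning
    girth≤1+∣D∣ : g ≤ suc ∣ D ∣
    girth≤1+∣D∣ = ≮⇒≥ λ short → noOddCycle⇒¬¬bipartite G (shortCore⇒noOddCycle short) ¬bipartite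

module _ {n} {G : Graph n} (bipartite : Bipartite G) where

  bipartite-dominates⇒∈ : ∀ {T x} → Dominates G T x → x ∈ T
  bipartite-dominates⇒∈ (inj₁ x∈T) = x∈T
  bipartite-dominates⇒∈ (inj₂ (_ , _ , _ , C , odd , _)) = ⊥-elim (bipartite⇒noOddCycle G bipartite C odd)

  bipartite⇒irredundant : ∀ S → OddCycleIrredundant G S
  bipartite⇒irredundant S v v∈S = v , inj₂ refl , inj₁ v∈S , λ dom → x∈p-y⇒x≢y (bipartite-dominates⇒∈ dom) refl

  bipartite⇒irOdd : IsIrOdd G n
  bipartite⇒irOdd = (⊤ , (bipartite⇒irredundant ⊤ , ⊤-maximal) , ∣⊤∣≡n n) , n≤∣maximal∣
    where
    ⊤-maximal : ∀ S′ → ⊤ ⊂ S′ → ¬ OddCycleIrredundant G S′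
    ⊤-maximal _ (_ , _ , _ , x∉⊤) _ = x∉⊤ ∈⊤
    n≤∣maximal∣ : ∀ S → MaximalOCI G S → n ≤ ∣ S ∣
    n≤∣maximal∣ S (_ , maximal) = subst (_≤ ∣ S ∣) (∣⊤∣≡n n) (p⊆q⇒∣p∣≤∣q∣ ⊤⊆S)
      where
      ⊤⊆S : ⊤ ⊆ S
      ⊤⊆S {x} _ with x ∈? S
      ... | yes x∈S = x∈S
      ... | no x∉S = ⊥-elim (maximal ⊤ ((λ _ → ∈⊤) , x , ∈⊤ , x∉S) (bipartite⇒irredundant ⊤))

mainTheorem17 : ∀ (n : ℕ) (G : Graph n) →
    ((¬ Bipartite G) → ∀ (g k r : ℕ) → IsGirth G g → IsKappaOdd G k → IsIrOdd G r →
      g ∸ 1 + k ≤ r)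
    × (Bipartite G → IsIrOdd G n)
mainTheorem17 n G = nonBipartite , bipartite⇒irOdd
  where
  nonBipartite : ¬ Bipartite G → ∀ g k r → IsGirth G g → IsKappaOdd G k → IsIrOdd G r → g ∸ 1 + k ≤ r
  nonBipartite ¬bipartite g _ _ girth (K , K-spec , refl) ((S , max , refl) , _) =
    girth∸1+∣K∣≤∣S∣ girth K-spec max ¬bipartite
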